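{- Let $(E,\rho)$ be a $k$-polymatroid and $(E,\rho^*)$ its $k$-dual. For every $e\in E$, $M^k_{\rho_{\setminus e}}=(M^k_{\rho^*_{/e}})^*$ and $M^k_{\rho_{/e}}=(M^k_{\rho^*_{\setminus e}})^*$.
   Context: A (integer) polymatroid is $(E,\rho)$ with $E$ finite, $\rho:2^E\to\mathbb{Z}$ normalized, nondecreasing and submodular; a $k$-polymatroid has $\rho(\{e\})\le k$ for all $e$. Deletion $\rho_{\setminus e}$ is restriction to $E-e$, contraction $\rho_{/e}(Y)=\rho(Y\cup e)-\rho(\{e\})$ on $E-e$. The $k$-dual is $(E,\rho^*)$ with $\rho^*(X)=k|X|-\rho(E)+\rho(E-X)$. Natural matroid $M_\rho$: pairwise disjoint sets $X_e$ with $|X_e|=\rho(\{e\})$, $X_A=\bigcup_{e\in A}X_e$, rank $r(X)=\min\{\rho(A)+|X-X_A|:A\subseteq E\}$ on $X_E$. The $k$-natural matroid $M^k_\rho$ is obtained from $M_\rho$ by, for each $e$, freely adding (iterated principal extension to the set $X_e$, i.e. each new element $u$ satisfies $r(Y\cup u)=r(Y)$ iff $X_e\subseteq\mathrm{cl}(Y)$) a set $U_e$ of $k-\rho(\{e\})$ new elements; its ground set is $\bigcup_e Y_e$ with $Y_e=X_e\cup U_e$, so $|Y_e|=k$ and the $k$-natural matroids of $k$-polymatroids on the same set may be taken on a common ground set. -}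

module Defs where

open import Data.Nat as ℕ using (ℕ; zero; suc)
open import Data.Integer as ℤ using (ℤ; +_; _-_; _+_; _⊓_; _≤_; ∣_∣)
open import Data.Bool using (Bool; true; false; if_then_else_; _∧_)
open import Data.Fin using (Fin; toℕ)
open import Data.Fin.Subset as Sub using (Subset; ⁅_⁆; _∪_; _∩_; _─_; ∁; _⊆_; inside; outside)
open import Data.Vec as Vec using (Vec; []; _∷_; lookup; replicate; insertAt; updateAt; _[_]≔_; zipWith; tabulate)
open import Data.List as List using (List; []; _∷_; foldr; foldl; allFin; concatMap; filter; map)
open import Data.Product using (_×_; _,_)
open import Relation.Nullary using (does)
open import Relation.Binary.PropositionalEquality using (_≡_)

record IsKPolymatroid {n : ℕ} (k : ℕ) (ρ : Subset n → ℤ) : Set where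
  field
    normalized    : ρ Sub.⊥ ≡ + 0
    nondecreasing : ∀ X Y → X ⊆ Y → ρ X ≤ ρ Y
    submodular    : ∀ X Y → ρ (X ∪ Y) + ρ (X ∩ Y) ≤ ρ X + ρ Y
    bounded       : ∀ e → ρ ⁅ e ⁆ ≤ + k

kDual : {n : ℕ} → ℕ → (Subset n → ℤ) → Subset n → ℤ
kDual k ρ X = (+ (k ℕ.* Sub.∣ X ∣) - ρ Sub.⊤) + ρ (∁ X)

-- E = Fin (suc n), e ∈ E; E - e is identified with Fin n via punchIn e
-- (a subset Y of E - e becomes insertAt Y e false).
-- deletion ρ\e (Y) = ρ(Y)
deletion : {n : ℕ} → (Subset (suc n) → ℤ) → Fin (suc n) → Subset n → ℤ
deletion ρ e Y = ρ (insertAt Y e outside)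

contraction : {n : ℕ} → (Subset (suc n) → ℤ) → Fin (suc n) → Subset n → ℤ
contraction ρ e Y = ρ (insertAt Y e inside) - ρ ⁅ e ⁆

-- Matroids on the common ground set Fin n × Fin k (element (e , i) is the
-- i-th element of Y_e); subsets are 'Vec (Subset k) n', rank functions
-- are maps MSub n k → ℤ.

MSub : ℕ → ℕ → Set
MSub n k = Vec (Subset k) n

card : {n k : ℕ} → MSub n k → ℕ
card Z = Vec.sum (Vec.map Sub.∣_∣ Z)

mfull : {n k : ℕ} → MSub n k
mfull = replicate _ Sub.⊤

mcompl : {n k : ℕ} → MSub n k → MSub n k
mcompl = Vec.map ∁

mminus : {n k : ℕ} → MSub n k → MSub n k → MSub n k
mminus = zipWith _─_

mdual : {n k : ℕ} → (MSub n k → ℤ) → MSub n k → ℤ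
mdual r Z = (+ card Z - r mfull) + r (mcompl Z)

mmem : {n k : ℕ} → MSub n k → Fin n → Fin k → Bool
mmem Z e i = lookup (lookup Z e) i

mset : {n k : ℕ} → MSub n k → Fin n → Fin k → Bool → MSub n k
mset Z e i b = updateAt Z e (λ S → S [ i ]≔ b)

allSubsets : (n : ℕ) → List (Subset n)
allSubsets zero    = [] ∷ []
allSubsets (suc n) = concatMap (λ S → (outside ∷ S) ∷ (inside ∷ S) ∷ []) (allSubsets n)

allB : {A : Set} → (A → Bool) → List A → Bool
allB p = foldr (λ x b → p x ∧ b) true

module KNatural {n : ℕ} (k : ℕ) (ρ : Subset n → ℤ) where

  size : Fin n → ℕ
  size e = ∣ ρ ⁅ e ⁆ ∣

  -- X_e = { (e , i) : i < ρ({e}) },  U_e = { (e , i) : ρ({e}) ≤ i < k }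
  inX : Fin n → Fin k → Bool
  inX e i = toℕ i ℕ.<ᵇ size e

  XA : Subset n → MSub n k
  XA A = tabulate (λ e → tabulate (λ i → lookup A e ∧ inX e i))

  natRank : MSub n k → ℤ
  natRank Z = foldr (λ A m → (ρ A + + card (mminus Z (XA A))) ⊓ m)
                    (ρ Sub.⊤ + + card (mminus Z (XA Sub.⊤)))
                    (allSubsets n)

  -- X_e ⊆ cl_r(Z), i.e. r(Z ∪ x) = r(Z) for every x ∈ X_e
  spans : (MSub n k → ℤ) → MSub n k → Fin n → Bool
  spans r Z e = allB (λ i → if inX e i
                            then does (r (mset Z e i true) ℤ.≟ r Z)
                            else true)
                    (allFin k)

  -- principal extension of r by the new element (e , i) to the set X_e:
  -- r'(Z ∪ u) = r(Z) if X_e ⊆ cl(Z), and r(Z) + 1 otherwise.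
  freeExt : (MSub n k → ℤ) → Fin n × Fin k → MSub n k → ℤ
  freeExt r (e , i) Z =
    if mmem Z e i
    then (let Z' = mset Z e i false in
          r Z' + (if spans r Z' e then + 0 else + 1))
    else r Z

  newElems : List (Fin n × Fin k)
  newElems = concatMap (λ e → map (λ i → e , i)
                                  (filter (λ i → size e ℕ.≤? toℕ i) (allFin k)))
                       (allFin n)

  rank : MSub n k → ℤ
  rank = foldl freeExt natRank newElems

kNatural : {n : ℕ} (k : ℕ) → (Subset n → ℤ) → MSub n k → ℤ
kNatural k ρ = KNatural.rank k ρ

module Submission where

-- For σ nonnegative on singletons with σ(A ∪ e) ≤ σ(A) + σ(e), the k-natural matroid of σ has
-- rank r(Z) = min_A σ(A) + |Z − Y_A|, Y_A consisting of all k cells of the rows in A. Indeed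
-- r(Z) = min_A σ(A) + |Z − P_A| holds throughout the construction, P being X together with the
-- cells added so far and P_A its cells in the rows of A. Covering a new cell u of row e raises
-- the minimum for Z ∋ u by one over that for Z − u unless some minimiser A contains e, and this
-- happens exactly when adding cells of X_e to Z − u does not raise its rank: putting e into a
-- minimiser costs at most σ(e) = |X_e| and covers the cells of X_e.
-- If g is a k-polymatroid and σ its k-dual, substituting B = E − A in the formula and counting
-- |(G − Z) − Y_B| row by row gives r_σ(G − Z) = r_g(Z) + nk − |Z| − g(E) and r_σ(G) = nk − g(E),
-- so M^k_g = (M^k_σ)*. Deletion and contraction preserve k-polymatroids, and (ρ*)/e = (ρ\e)*,
-- (ρ*)\e = (ρ/e)*.

open import Defs
open import Data.Bool using (Bool; true; false; not; _∧_; _∨_; if_then_else_; T)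
import Data.Bool.Properties as 𝔹
open import Data.Fin using (Fin; zero; suc; toℕ; punchIn)
open import Data.Fin.Properties using (punchInᵢ≢i; toℕ<n; any?) renaming (_≟_ to _≟ᶠ_)
open import Data.Fin.Subset as Sub using (Subset; ⁅_⁆; _∪_; _∩_; ∁; _⊆_; inside; outside)
open import Data.Fin.Subset.Properties
  using ( ⊆-min; s⊆s; out⊆; in⊆in; drop-∷-⊆; ∪-∩-booleanAlgebra; x∈⁅x⁆; x≢y⇒x∉⁅y⁆
        ; ∣⁅x⁆∣≡1; p∪∁p≡⊤; ∪-identityʳ; ∪-zeroʳ )
import Algebra.Lattice.Properties.BooleanAlgebra as BooleanAlgebra
open import Data.Integer using (ℤ; +_; -_; _+_; _-_; _≤_; _⊓_; +≤+)
import Data.Integer.Properties as ℤ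
import Data.Integer.Tactic.RingSolver as ℤ-Ring
open import Data.List as List using (List; []; _∷_)
open import Data.List.Membership.Propositional using (_∈_; lose)
open import Data.List.Membership.Propositional.Properties using (∈-concatMap⁺; ∈-map⁺; ∈-filter⁺; ∈-allFin)
open import Data.List.Relation.Unary.Any using (here; there)
open import Data.Nat as ℕ using (ℕ; zero; suc)
import Data.Nat.Properties as ℕ
import Data.Nat.Tactic.RingSolver as ℕ-Ring
open import Algebra.Properties.Semiring.Sum ℕ.+-*-semiring
  using (sum; sum-cong-≗; sum-remove; ∑-distrib-+; *-distribˡ-sum)
open import Data.Product using (_×_; _,_; ∃; proj₁; proj₂)
open import Data.Product.Properties using (≡-dec)
open import Data.Sum using (inj₁; inj₂)
open import Data.Vec as Vec using ([]; _∷_; lookup; insertAt; zipWith; replicate)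
import Data.Vec.Properties as Vec
open import Function using (_∘_)
open import Relation.Binary.PropositionalEquality
open import Relation.Nullary using (¬_; Dec; yes; no; does; contradiction)
open import Relation.Nullary.Decidable using (dec-true; _×-dec_)

-- Counting cells

bit : Bool → ℕ
bit false = 0
bit true  = 1

count : ∀ {k} → (Fin k → Bool) → ℕ
count p = sum (bit ∘ p)

Grid : ℕ → ℕ → Set
Grid n k = Fin n → Fin k → Bool

gridCount : ∀ {n k} → Grid n k → ℕ
gridCount z = sum (count ∘ z)

noCells : ∀ {n k} → Grid n k
noCells _ _ = false

outsideRows : ∀ {n k} → Grid n k → Subset n → ℕ
outsideRows z A = gridCount (λ f j → z f j ∧ not (lookup A f))

AgreeExcept : ∀ {n k} → Grid n k → Grid n k → Fin n → Fin k → Set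
AgreeExcept z w e i = ∀ f j → (f , j) ≢ (e , i) → z f j ≡ w f j

sum-const : ∀ n c → sum {n} (λ _ → c) ≡ n ℕ.* c
sum-const zero    c = refl
sum-const (suc n) c = cong (c ℕ.+_) (sum-const n c)

sum-mono-≤ : ∀ {n} {f g : Fin n → ℕ} → (∀ i → f i ℕ.≤ g i) → sum f ℕ.≤ sum g
sum-mono-≤ {zero}  f≤g = ℕ.z≤n
sum-mono-≤ {suc n} f≤g = ℕ.+-mono-≤ (f≤g zero) (sum-mono-≤ (f≤g ∘ suc))

-- Both sides are f i + g i + ∑_{j ≢ i} f j.
sum-update : ∀ {n} (f g : Fin n → ℕ) i → (∀ j → j ≢ i → f j ≡ g j) →
  sum f ℕ.+ g i ≡ sum g ℕ.+ f i
sum-update {suc n} f g i f≗g = begin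
  sum f ℕ.+ g i                               ≡⟨ cong (ℕ._+ g i) (sum-remove {i = i} f) ⟩
  f i ℕ.+ sum (f ∘ punchIn i) ℕ.+ g i         ≡⟨ cong (λ s → f i ℕ.+ s ℕ.+ g i) rest ⟩
  f i ℕ.+ sum (g ∘ punchIn i) ℕ.+ g i         ≡⟨ swap (f i) _ (g i) ⟩
  g i ℕ.+ sum (g ∘ punchIn i) ℕ.+ f i         ≡⟨ cong (ℕ._+ f i) (sum-remove {i = i} g) ⟨
  sum g ℕ.+ f i                               ∎
  where
  open ≡-Reasoning
  rest : sum (f ∘ punchIn i) ≡ sum (g ∘ punchIn i)
  rest = sum-cong-≗ (λ j → f≗g (punchIn i j) (punchInᵢ≢i i j))
  swap : ∀ a s b → a ℕ.+ s ℕ.+ b ≡ b ℕ.+ s ℕ.+ a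
  swap = ℕ-Ring.solve-∀

count-cong : ∀ {k} {p q : Fin k → Bool} → (∀ j → p j ≡ q j) → count p ≡ count q
count-cong p≗q = sum-cong-≗ (cong bit ∘ p≗q)

gridCount-cong : ∀ {n k} {z w : Grid n k} → (∀ f j → z f j ≡ w f j) → gridCount z ≡ gridCount w
gridCount-cong z≗w = sum-cong-≗ (λ f → count-cong (z≗w f))

count-false : ∀ k → count {k} (λ _ → false) ≡ 0
count-false k = trans (sum-const k 0) (ℕ.*-zeroʳ k)

gridCount-noCells : ∀ n k → gridCount (noCells {n} {k}) ≡ 0
gridCount-noCells n k = trans (sum-cong-≗ {n} (λ _ → count-false k)) (trans (sum-const n 0) (ℕ.*-zeroʳ n))

count-+-count-not : ∀ {k} (p : Fin k → Bool) → count p ℕ.+ count (not ∘ p) ≡ k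
count-+-count-not {k} p = begin
  count p ℕ.+ count (not ∘ p)              ≡⟨ ∑-distrib-+ (bit ∘ p) (bit ∘ not ∘ p) ⟨
  sum (λ j → bit (p j) ℕ.+ bit (not (p j))) ≡⟨ sum-cong-≗ (λ j → one (p j)) ⟩
  sum {k} (λ _ → 1)                        ≡⟨ sum-const k 1 ⟩
  k ℕ.* 1                                  ≡⟨ ℕ.*-identityʳ k ⟩
  k                                        ∎
  where
  open ≡-Reasoning
  one : ∀ b → bit b ℕ.+ bit (not b) ≡ 1
  one false = refl
  one true  = refl

bit-∧-not-≤ : ∀ a b → bit (a ∧ not b) ℕ.≤ bit a
bit-∧-not-≤ false b     = ℕ.z≤n
bit-∧-not-≤ true  false = ℕ.≤-refl
bit-∧-not-≤ true  true  = ℕ.z≤n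

count-∧-not-+-≤ : ∀ {k} s (p q : Fin k → Bool) → s ℕ.≤ k →
  (∀ j → (toℕ j ℕ.<ᵇ s) ≡ true → p j ≡ true × q j ≡ true) →
  count (λ j → p j ∧ not (q j)) ℕ.+ s ℕ.≤ count p
count-∧-not-+-≤ zero p q _ _ rewrite ℕ.+-identityʳ (count (λ j → p j ∧ not (q j))) =
  sum-mono-≤ (λ j → bit-∧-not-≤ (p j) (q j))
count-∧-not-+-≤ {suc k} (suc s) p q (ℕ.s≤s s≤k) pq with pq zero refl
... | p₀ , q₀ rewrite p₀ | q₀ =
  subst (ℕ._≤ suc (count (p ∘ suc))) (sym (ℕ.+-suc _ s))
    (ℕ.s≤s (count-∧-not-+-≤ s (p ∘ suc) (q ∘ suc) s≤k (pq ∘ suc)))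

gridCount-update : ∀ {n k} (z w : Grid n k) e i →
  AgreeExcept z w e i → gridCount z ℕ.+ bit (w e i) ≡ gridCount w ℕ.+ bit (z e i)
gridCount-update z w e i z≗w = ℕ.+-cancelʳ-≡ (count (w e)) _ _ (begin
  gridCount z ℕ.+ bit (w e i) ℕ.+ count (w e)    ≡⟨ swap (gridCount z) (bit (w e i)) (count (w e)) ⟩
  gridCount z ℕ.+ count (w e) ℕ.+ bit (w e i)    ≡⟨ cong (ℕ._+ bit (w e i)) rows ⟩
  gridCount w ℕ.+ count (z e) ℕ.+ bit (w e i)    ≡⟨ ℕ.+-assoc (gridCount w) (count (z e)) (bit (w e i)) ⟩
  gridCount w ℕ.+ (count (z e) ℕ.+ bit (w e i))  ≡⟨ cong (gridCount w ℕ.+_) row ⟩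
  gridCount w ℕ.+ (count (w e) ℕ.+ bit (z e i))  ≡⟨ swap′ (gridCount w) (count (w e)) (bit (z e i)) ⟩
  gridCount w ℕ.+ bit (z e i) ℕ.+ count (w e)    ∎)
  where
  open ≡-Reasoning
  swap : ∀ a b c → a ℕ.+ b ℕ.+ c ≡ a ℕ.+ c ℕ.+ b
  swap = ℕ-Ring.solve-∀
  swap′ : ∀ a b c → a ℕ.+ (b ℕ.+ c) ≡ a ℕ.+ c ℕ.+ b
  swap′ = ℕ-Ring.solve-∀
  rows : gridCount z ℕ.+ count (w e) ≡ gridCount w ℕ.+ count (z e)
  rows = sum-update (count ∘ z) (count ∘ w) e
           (λ f f≢e → count-cong (λ j → z≗w f j (f≢e ∘ cong proj₁)))
  row : count (z e) ℕ.+ bit (w e i) ≡ count (w e) ℕ.+ bit (z e i)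
  row = sum-update (bit ∘ z e) (bit ∘ w e) i (λ j j≢i → cong bit (z≗w e j (j≢i ∘ cong proj₂)))

∣∣≡count : ∀ {k} (S : Subset k) → Sub.∣ S ∣ ≡ count (lookup S)
∣∣≡count []            = refl
∣∣≡count (inside ∷ S)  = cong suc (∣∣≡count S)
∣∣≡count (outside ∷ S) = ∣∣≡count S

card≡gridCount : ∀ {n k} (Z : MSub n k) → card Z ≡ gridCount (mmem Z)
card≡gridCount []      = refl
card≡gridCount (S ∷ Z) = cong₂ ℕ._+_ (∣∣≡count S) (card≡gridCount Z)

-- Minima over all subsets

minOverSubsets : ∀ {n} → (Subset n → ℤ) → ℤ
minOverSubsets {n} h = List.foldr (λ A m → h A ⊓ m) (h Sub.⊤) (allSubsets n)

∈-allSubsets : ∀ {n} (A : Subset n) → A ∈ allSubsets n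
∈-allSubsets []      = here refl
∈-allSubsets (b ∷ A) = ∈-extend b (∈-allSubsets A)
  where
  ∈-extend : ∀ {L} b → A ∈ L → (b ∷ A) ∈ List.concatMap (λ S → (outside ∷ S) ∷ (inside ∷ S) ∷ []) L
  ∈-extend {_ ∷ _} outside (here refl) = here refl
  ∈-extend {_ ∷ _} inside  (here refl) = there (here refl)
  ∈-extend {_ ∷ _} b       (there A∈L) = there (there (∈-extend b A∈L))

module _ {n : ℕ} (h : Subset n → ℤ) where

  private
    minOver : ℤ → List (Subset n) → ℤ
    minOver = List.foldr (λ A m → h A ⊓ m)

  minOverSubsets-≤ : ∀ A → minOverSubsets h ≤ h A
  minOverSubsets-≤ A = go (allSubsets n) (∈-allSubsets A)
    where
    go : ∀ L → A ∈ L → minOver (h Sub.⊤) L ≤ h A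
    go (_ ∷ L) (here refl) = ℤ.i⊓j≤i _ _
    go (_ ∷ L) (there A∈L) = ℤ.≤-trans (ℤ.i⊓j≤j _ _) (go L A∈L)

  minOverSubsets-attained : ∃ λ A → minOverSubsets h ≡ h A
  minOverSubsets-attained = go (allSubsets n)
    where
    go : ∀ L → ∃ λ A → minOver (h Sub.⊤) L ≡ h A
    go []      = Sub.⊤ , refl
    go (B ∷ L) with ℤ.⊓-sel (h B) (minOver (h Sub.⊤) L)
    ... | inj₁ eq = B , eq
    ... | inj₂ eq = let A , eq′ = go L in A , trans eq eq′

  minOverSubsets-unique : ∀ m → (∀ A → m ≤ h A) → (∃ λ A → h A ≡ m) → minOverSubsets h ≡ m
  minOverSubsets-unique m m≤h (A , hA≡m) = ℤ.≤-antisym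
    (subst (minOverSubsets h ≤_) hA≡m (minOverSubsets-≤ A))
    (let B , eq = minOverSubsets-attained in subst (m ≤_) (sym eq) (m≤h B))

minOverSubsets-cong : ∀ {n} {h h′ : Subset n → ℤ} → (∀ A → h A ≡ h′ A) →
  minOverSubsets h ≡ minOverSubsets h′
minOverSubsets-cong {n} {h} {h′} h≗h′ = go (allSubsets n)
  where
  go : ∀ L → List.foldr (λ A m → h A ⊓ m) (h Sub.⊤) L ≡ List.foldr (λ A m → h′ A ⊓ m) (h′ Sub.⊤) L
  go []      = h≗h′ Sub.⊤
  go (A ∷ L) = cong₂ _⊓_ (h≗h′ A) (go L)

minOverSubsets-+ : ∀ {n} (h : Subset n → ℤ) c → minOverSubsets (λ A → h A + c) ≡ minOverSubsets h + c
minOverSubsets-+ h c = minOverSubsets-unique (λ A → h A + c) (minOverSubsets h + c)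
  (λ A → ℤ.+-monoˡ-≤ c (minOverSubsets-≤ h A))
  (let A , eq = minOverSubsets-attained h in A , cong (_+ c) (sym eq))

minOverSubsets-∘∁ : ∀ {n} (h : Subset n → ℤ) → minOverSubsets (h ∘ ∁) ≡ minOverSubsets h
minOverSubsets-∘∁ {n} h = minOverSubsets-unique (h ∘ ∁) (minOverSubsets h)
  (λ A → minOverSubsets-≤ h (∁ A))
  (let A , eq = minOverSubsets-attained h in
   ∁ A , trans (cong h (BooleanAlgebra.¬-involutive (∪-∩-booleanAlgebra n) A)) (sym eq))

-- Single elements and single cells

lookup-⁅⁆-self : ∀ {n} (e : Fin n) → lookup ⁅ e ⁆ e ≡ true
lookup-⁅⁆-self e = Vec.[]=⇒lookup (x∈⁅x⁆ e)

lookup-⁅⁆-other : ∀ {n} {e f : Fin n} → f ≢ e → lookup ⁅ e ⁆ f ≡ false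
lookup-⁅⁆-other {e = e} {f} f≢e = 𝔹.¬-not (x≢y⇒x∉⁅y⁆ f≢e ∘ Vec.lookup⇒[]= f ⁅ e ⁆)

lookup-∪⁅⁆-self : ∀ {n} (A : Subset n) e → lookup (A ∪ ⁅ e ⁆) e ≡ true
lookup-∪⁅⁆-self A e = begin
  lookup (A ∪ ⁅ e ⁆) e         ≡⟨ Vec.lookup-zipWith _∨_ e A ⁅ e ⁆ ⟩
  lookup A e ∨ lookup ⁅ e ⁆ e  ≡⟨ cong (lookup A e ∨_) (lookup-⁅⁆-self e) ⟩
  lookup A e ∨ true            ≡⟨ 𝔹.∨-zeroʳ _ ⟩
  true                         ∎
  where open ≡-Reasoning

lookup-∪⁅⁆-other : ∀ {n} (A : Subset n) {e f} → f ≢ e → lookup (A ∪ ⁅ e ⁆) f ≡ lookup A f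
lookup-∪⁅⁆-other A {e} {f} f≢e = begin
  lookup (A ∪ ⁅ e ⁆) f         ≡⟨ Vec.lookup-zipWith _∨_ f A ⁅ e ⁆ ⟩
  lookup A f ∨ lookup ⁅ e ⁆ f  ≡⟨ cong (lookup A f ∨_) (lookup-⁅⁆-other f≢e) ⟩
  lookup A f ∨ false           ≡⟨ 𝔹.∨-identityʳ _ ⟩
  lookup A f                   ∎
  where open ≡-Reasoning

lookup-─ : ∀ {n} (S T : Subset n) i → lookup (S Sub.─ T) i ≡ lookup S i ∧ not (lookup T i)
lookup-─ (s ∷ S) (inside  ∷ T) zero    = sym (𝔹.∧-zeroʳ s)
lookup-─ (s ∷ S) (outside ∷ T) zero    = sym (𝔹.∧-identityʳ s)
lookup-─ (s ∷ S) (t ∷ T)       (suc i) = lookup-─ S T i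

∪⁅⁆-idem : ∀ {n} (A : Subset n) e → lookup A e ≡ true → A ∪ ⁅ e ⁆ ≡ A
∪⁅⁆-idem (inside ∷ A) zero    _   = cong (inside ∷_) (∪-identityʳ A)
∪⁅⁆-idem (a ∷ A)      (suc e) A∋e = cong₂ _∷_ (𝔹.∨-identityʳ a) (∪⁅⁆-idem A e A∋e)

∣∪⁅⁆∣ : ∀ {n} (A : Subset n) e → lookup A e ≡ false → Sub.∣ A ∪ ⁅ e ⁆ ∣ ≡ suc Sub.∣ A ∣
∣∪⁅⁆∣ (outside ∷ A) zero    _   = cong (suc ∘ Sub.∣_∣) (∪-identityʳ A)
∣∪⁅⁆∣ (inside  ∷ A) (suc e) A∌e = cong suc (∣∪⁅⁆∣ A e A∌e)
∣∪⁅⁆∣ (outside ∷ A) (suc e) A∌e = ∣∪⁅⁆∣ A e A∌e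

∁∪∁⁅⁆≡⊤ : ∀ {n} (A : Subset n) e → lookup A e ≡ false → ∁ A ∪ ∁ ⁅ e ⁆ ≡ Sub.⊤
∁∪∁⁅⁆≡⊤ {suc n} (outside ∷ A) zero _ =
  cong (inside ∷_) (trans (cong (∁ A ∪_) (BooleanAlgebra.¬⊥≈⊤ (∪-∩-booleanAlgebra n))) (∪-zeroʳ (∁ A)))
∁∪∁⁅⁆≡⊤ (a ∷ A) (suc e) A∌e = cong₂ _∷_ (𝔹.∨-zeroʳ (not a)) (∁∪∁⁅⁆≡⊤ A e A∌e)

mmem-mset-self : ∀ {n k} (Z : MSub n k) e i b → mmem (mset Z e i b) e i ≡ b
mmem-mset-self Z e i b rewrite Vec.lookup∘updateAt e {λ S → S Vec.[ i ]≔ b} Z =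
  Vec.lookup∘updateAt i (lookup Z e)

mmem-mset-other : ∀ {n k} (Z : MSub n k) e i b → AgreeExcept (mmem (mset Z e i b)) (mmem Z) e i
mmem-mset-other Z e i b f j fj≢ei with f ≟ᶠ e
... | no f≢e rewrite Vec.lookup∘updateAt′ f e {λ S → S Vec.[ i ]≔ b} f≢e Z = refl
... | yes refl rewrite Vec.lookup∘updateAt e {λ S → S Vec.[ i ]≔ b} Z =
  Vec.lookup∘updateAt′ j i (fj≢ei ∘ cong (e ,_)) (lookup Z e)

addCell : ∀ {n k} → Grid n k → Fin n → Fin k → Grid n k
addCell P e i f j = P f j ∨ (does (f ≟ᶠ e) ∧ does (j ≟ᶠ i))

addCell-self : ∀ {n k} (P : Grid n k) e i → addCell P e i e i ≡ true
addCell-self P e i rewrite dec-true (e ≟ᶠ e) refl | dec-true (i ≟ᶠ i) refl = 𝔹.∨-zeroʳ (P e i)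

addCell-other : ∀ {n k} (P : Grid n k) e i → AgreeExcept (addCell P e i) P e i
addCell-other P e i f j fj≢ei with f ≟ᶠ e | j ≟ᶠ i
... | yes refl | yes refl = contradiction refl fj≢ei
... | yes _    | no _     = 𝔹.∨-identityʳ (P f j)
... | no _     | _        = 𝔹.∨-identityʳ (P f j)

addCells : ∀ {n k} → Grid n k → List (Fin n × Fin k) → Grid n k
addCells = List.foldl (λ P u → addCell P (proj₁ u) (proj₂ u))

addCells-⊇ : ∀ {n k} (P : Grid n k) L f j → P f j ≡ true → addCells P L f j ≡ true
addCells-⊇ P []            f j Pfj = Pfj
addCells-⊇ P ((e , i) ∷ L) f j Pfj =
  addCells-⊇ (addCell P e i) L f j (cong (_∨ _) Pfj)

addCells-∈ : ∀ {n k} (P : Grid n k) L f j → (f , j) ∈ L → addCells P L f j ≡ true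
addCells-∈ P (_ ∷ L) f j (here refl) = addCells-⊇ (addCell P f j) L f j (addCell-self P f j)
addCells-∈ P ((e , i) ∷ L) f j (there fj∈L) = addCells-∈ (addCell P e i) L f j fj∈L

-- The rank of a k-natural matroid

allB-tabulate-true : ∀ {A : Set} {k} (p : A → Bool) (g : Fin k → A) →
  allB p (List.tabulate g) ≡ true → ∀ j → p (g j) ≡ true
allB-tabulate-true {k = suc k} p g all-p j with p (g zero) in p₀ | j
... | true | zero  = p₀
... | true | suc j = allB-tabulate-true p (g ∘ suc) all-p j

allB-tabulate-false : ∀ {A : Set} {k} (p : A → Bool) (g : Fin k → A) →
  allB p (List.tabulate g) ≡ false → ∃ λ j → p (g j) ≡ false
allB-tabulate-false {k = suc k} p g ¬all-p with p (g zero) in p₀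
... | false = zero , p₀
... | true  = let j , pj = allB-tabulate-false p (g ∘ suc) ¬all-p in suc j , pj

allB-cong : ∀ {A : Set} {p q : A → Bool} → (∀ x → p x ≡ q x) → ∀ L → allB p L ≡ allB q L
allB-cong p≗q []      = refl
allB-cong p≗q (x ∷ L) = cong₂ _∧_ (p≗q x) (allB-cong p≗q L)

does-true : ∀ {A : Set} (a? : Dec A) → does a? ≡ true → A
does-true (yes a) _ = a

does-false : ∀ {A : Set} (a? : Dec A) → does a? ≡ false → ¬ A
does-false (no ¬a) _ = ¬a

module RankFormula {n : ℕ} (k : ℕ) (σ : Subset n → ℤ)
  (σ-⁅⁆-nonneg : ∀ e → + 0 ≤ σ ⁅ e ⁆)
  (σ-∪⁅⁆-≤ : ∀ A e → σ (A ∪ ⁅ e ⁆) ≤ σ A + σ ⁅ e ⁆) where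

  open KNatural k σ

  IncludesX : Grid n k → Set
  IncludesX P = ∀ f j → inX f j ≡ true → P f j ≡ true

  uncovered : Grid n k → Grid n k → Subset n → ℕ
  uncovered P z A = gridCount (λ f j → z f j ∧ not (lookup A f ∧ P f j))

  cost : Grid n k → Grid n k → Subset n → ℤ
  cost P z A = σ A + + uncovered P z A

  -- min_A σ(A) + |Z − P_A|: the rank of M_σ once the cells of P outside X are freely added
  rankWith : Grid n k → MSub n k → ℤ
  rankWith P Z = minOverSubsets (cost P (mmem Z))

  cost-cong : ∀ {P Q z w} → (∀ f j → z f j ≡ w f j) → (∀ f j → w f j ≡ true → P f j ≡ Q f j) →
    ∀ A → cost P z A ≡ cost Q w A
  cost-cong {P} {Q} {z} {w} z≗w P≗Q A = cong (λ c → σ A + + c) (gridCount-cong cell)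
    where
    cell : ∀ f j → z f j ∧ not (lookup A f ∧ P f j) ≡ w f j ∧ not (lookup A f ∧ Q f j)
    cell f j rewrite z≗w f j with w f j in wfj
    ... | true  = cong (λ b → not (lookup A f ∧ b)) (P≗Q f j wfj)
    ... | false = refl

  natRank≡rankWith-inX : ∀ Z → natRank Z ≡ rankWith inX Z
  natRank≡rankWith-inX Z = minOverSubsets-cong (λ A →
    cong (λ c → σ A + + c) (trans (card≡gridCount (mminus Z (XA A))) (gridCount-cong (cell A))))
    where
    cell : ∀ A f j → mmem (mminus Z (XA A)) f j ≡ mmem Z f j ∧ not (lookup A f ∧ inX f j)
    cell A f j
      rewrite Vec.lookup-zipWith Sub._─_ f Z (XA A)
            | lookup-─ (lookup Z f) (lookup (XA A) f) j
            | Vec.lookup∘tabulate (λ e → Vec.tabulate (λ i → lookup A e ∧ inX e i)) f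
            | Vec.lookup∘tabulate (λ i → lookup A f ∧ inX f i) j = refl

  cost-addCell : ∀ {P Q z z′} e x → AgreeExcept Q P e x → AgreeExcept z′ z e x →
    Q e x ≡ true → z′ e x ≡ true → z e x ≡ false →
    ∀ A → cost Q z′ A ≡ cost P z A + + bit (not (lookup A e))
  cost-addCell {P} {Q} {z} {z′} e x Q≗P z′≗z Qex z′ex zex A = begin
    σ A + + gridCount G                          ≡⟨ cong (λ c → σ A + + c) count-G ⟩
    σ A + + (gridCount H ℕ.+ bit (not (lookup A e))) ≡⟨ cong (λ c → σ A + c) (ℤ.pos-+ (gridCount H) _) ⟩
    σ A + (+ gridCount H + + bit (not (lookup A e))) ≡⟨ ℤ.+-assoc (σ A) _ _ ⟨
    σ A + + gridCount H + + bit (not (lookup A e))   ∎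
    where
    open ≡-Reasoning
    G H : Grid n k
    G f j = z′ f j ∧ not (lookup A f ∧ Q f j)
    H f j = z f j ∧ not (lookup A f ∧ P f j)
    G≗H : AgreeExcept G H e x
    G≗H f j fj≢ex = cong₂ (λ a b → a ∧ not (lookup A f ∧ b)) (z′≗z f j fj≢ex) (Q≗P f j fj≢ex)
    Gex : G e x ≡ not (lookup A e)
    Gex rewrite z′ex | Qex = cong not (𝔹.∧-identityʳ (lookup A e))
    Hex : H e x ≡ false
    Hex rewrite zex = refl
    count-G : gridCount G ≡ gridCount H ℕ.+ bit (not (lookup A e))
    count-G = begin
      gridCount G                          ≡⟨ ℕ.+-identityʳ (gridCount G) ⟨
      gridCount G ℕ.+ bit false            ≡⟨ cong (λ b → gridCount G ℕ.+ bit b) Hex ⟨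
      gridCount G ℕ.+ bit (H e x)          ≡⟨ gridCount-update G H e x G≗H ⟩
      gridCount H ℕ.+ bit (G e x)          ≡⟨ cong (λ b → gridCount H ℕ.+ bit b) Gex ⟩
      gridCount H ℕ.+ bit (not (lookup A e)) ∎

  uncovered-∪⁅⁆-+-≤ : ∀ P z A e → lookup A e ≡ false → size e ℕ.≤ k →
    (∀ j → inX e j ≡ true → z e j ≡ true × P e j ≡ true) →
    uncovered P z (A ∪ ⁅ e ⁆) ℕ.+ size e ℕ.≤ uncovered P z A
  uncovered-∪⁅⁆-+-≤ P z A e A∌e s≤k X-row = ℕ.+-cancelʳ-≤ (count (u e)) _ _ (begin
    count∪ ℕ.+ s ℕ.+ count (u e)         ≡⟨ ℕ.+-assoc count∪ s _ ⟩
    count∪ ℕ.+ (s ℕ.+ count (u e))       ≡⟨ cong (count∪ ℕ.+_) (ℕ.+-comm s _) ⟩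
    count∪ ℕ.+ (count (u e) ℕ.+ s)       ≤⟨ ℕ.+-monoʳ-≤ count∪ row ⟩
    count∪ ℕ.+ count (v e)               ≡⟨ rows ⟩
    uncovered P z A ℕ.+ count (u e)      ∎)
    where
    open ℕ.≤-Reasoning
    s count∪ : ℕ
    s = size e
    count∪ = uncovered P z (A ∪ ⁅ e ⁆)
    u v : Grid n k
    u f j = z f j ∧ not (lookup (A ∪ ⁅ e ⁆) f ∧ P f j)
    v f j = z f j ∧ not (lookup A f ∧ P f j)
    rows : count∪ ℕ.+ count (v e) ≡ uncovered P z A ℕ.+ count (u e)
    rows = sum-update (count ∘ u) (count ∘ v) e (λ f f≢e →
      count-cong (λ j → cong (λ b → z f j ∧ not (b ∧ P f j)) (lookup-∪⁅⁆-other A f≢e)))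
    row : count (u e) ℕ.+ s ℕ.≤ count (v e)
    row = begin
      count (u e) ℕ.+ s                        ≡⟨ cong (ℕ._+ s) (count-cong (λ j →
        cong (λ b → z e j ∧ not (b ∧ P e j)) (lookup-∪⁅⁆-self A e))) ⟩
      count (λ j → z e j ∧ not (P e j)) ℕ.+ s  ≤⟨ count-∧-not-+-≤ s (z e) (P e) s≤k X-row ⟩
      count (z e)                              ≡⟨ count-cong (λ j →
        trans (cong (λ b → z e j ∧ not (b ∧ P e j)) A∌e) (𝔹.∧-identityʳ (z e j))) ⟨
      count (v e)                              ∎

  cost-∪⁅⁆-≤ : ∀ P z A e → lookup A e ≡ false → size e ℕ.≤ k →
    (∀ j → inX e j ≡ true → z e j ≡ true × P e j ≡ true) →
    cost P z (A ∪ ⁅ e ⁆) ≤ cost P z A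
  cost-∪⁅⁆-≤ P z A e A∌e s≤k X-row = begin
    σ (A ∪ ⁅ e ⁆) + + c∪            ≤⟨ ℤ.+-monoˡ-≤ (+ c∪) (σ-∪⁅⁆-≤ A e) ⟩
    σ A + σ ⁅ e ⁆ + + c∪            ≡⟨ cong (λ t → σ A + t + + c∪) σ⁅e⁆≡s ⟨
    σ A + + size e + + c∪           ≡⟨ ℤ.+-assoc (σ A) (+ size e) _ ⟩
    σ A + (+ size e + + c∪)         ≡⟨ cong (λ t → σ A + t) (ℤ.pos-+ (size e) c∪) ⟨
    σ A + + (size e ℕ.+ c∪)         ≤⟨ ℤ.+-monoʳ-≤ (σ A) (+≤+ (subst (ℕ._≤ uncovered P z A)
                                         (ℕ.+-comm c∪ (size e))
                                         (uncovered-∪⁅⁆-+-≤ P z A e A∌e s≤k X-row))) ⟩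
    σ A + + uncovered P z A         ∎
    where
    open ℤ.≤-Reasoning
    c∪ : ℕ
    c∪ = uncovered P z (A ∪ ⁅ e ⁆)
    -- size e is |σ{e}|, which is σ{e} only because σ{e} ≥ 0
    σ⁅e⁆≡s : + size e ≡ σ ⁅ e ⁆
    σ⁅e⁆≡s = ℤ.0≤i⇒+∣i∣≡i (σ-⁅⁆-nonneg e)

  spans-true : ∀ r Z e → spans r Z e ≡ true →
    ∀ x → inX e x ≡ true → r (mset Z e x true) ≡ r Z
  spans-true r Z e spanning x x∈X with allB-tabulate-true _ (λ j → j) spanning x
  ... | test rewrite x∈X = does-true (r (mset Z e x true) ℤ.≟ r Z) test

  spans-false : ∀ r Z e → spans r Z e ≡ false →
    ∃ λ x → inX e x ≡ true × r (mset Z e x true) ≢ r Z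
  spans-false r Z e ¬spanning with allB-tabulate-false _ (λ j → j) ¬spanning
  ... | x , test with inX e x in x∈X
  ...   | true = x , x∈X , does-false (r (mset Z e x true) ℤ.≟ r Z) test

  freeExt-cong : ∀ {r r′ : MSub n k → ℤ} → (∀ Z → r Z ≡ r′ Z) →
    ∀ u Z → freeExt r u Z ≡ freeExt r′ u Z
  freeExt-cong {r} {r′} r≗r′ (e , i) Z with mmem Z e i
  ... | false = r≗r′ Z
  ... | true  = cong₂ (λ a b → a + (if b then + 0 else + 1)) (r≗r′ _)
    (allB-cong (λ j → cong (λ t → if inX e j then t else true)
      (cong₂ (λ a b → does (a ℤ.≟ b)) (r≗r′ _) (r≗r′ _))) (List.allFin k))

  module FreeExtensionStep (P : Grid n k) (X⊆P : IncludesX P) (e : Fin n) (i : Fin k) where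

    P⁺ : Grid n k
    P⁺ = addCell P e i

    module _ (Z : MSub n k) (Z∋ei : mmem Z e i ≡ true) where

      private
        Z′ : MSub n k
        Z′ = mset Z e i false
        rank⁻ rank⁺ : ℤ
        rank⁻ = rankWith P Z′
        rank⁺ = rankWith P⁺ Z

      cost-split : ∀ A → cost P⁺ (mmem Z) A ≡ cost P (mmem Z′) A + + bit (not (lookup A e))
      cost-split = cost-addCell e i (addCell-other P e i)
        (λ f j fj≢ei → sym (mmem-mset-other Z e i false f j fj≢ei))
        (addCell-self P e i) Z∋ei (mmem-mset-self Z e i false)

      rank⁻≤rank⁺ : rank⁻ ≤ rank⁺
      rank⁻≤rank⁺ = let A , rank⁺≡costA = minOverSubsets-attained (cost P⁺ (mmem Z)) in begin
        rank⁻                                          ≤⟨ minOverSubsets-≤ _ A ⟩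
        cost P (mmem Z′) A                             ≤⟨ ℤ.i≤i+j _ (+ bit (not (lookup A e))) ⟩
        cost P (mmem Z′) A + + bit (not (lookup A e))  ≡⟨ cost-split A ⟨
        cost P⁺ (mmem Z) A                             ≡⟨ rank⁺≡costA ⟨
        rank⁺                                          ∎
        where open ℤ.≤-Reasoning

      rank⁺≤rank⁻+1 : rank⁺ ≤ rank⁻ + + 1
      rank⁺≤rank⁻+1 = let A , rank⁻≡costA = minOverSubsets-attained (cost P (mmem Z′)) in begin
        rank⁺                                          ≤⟨ minOverSubsets-≤ _ A ⟩
        cost P⁺ (mmem Z) A                             ≡⟨ cost-split A ⟩
        cost P (mmem Z′) A + + bit (not (lookup A e))  ≤⟨ ℤ.+-monoʳ-≤ (cost P (mmem Z′) A)
                                                            (+≤+ (bit≤1 (not (lookup A e)))) ⟩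
        cost P (mmem Z′) A + + 1                       ≡⟨ cong (_+ + 1) rank⁻≡costA ⟨
        rank⁻ + + 1                                    ∎
        where
        open ℤ.≤-Reasoning
        bit≤1 : ∀ b → bit b ℕ.≤ 1
        bit≤1 false = ℕ.z≤n
        bit≤1 true  = ℕ.≤-refl

      rank⁺≤cost : ∀ B → lookup B e ≡ true → rank⁺ ≤ cost P (mmem Z′) B
      rank⁺≤cost B B∋e = ℤ.≤-trans (minOverSubsets-≤ _ B) (ℤ.≤-reflexive (begin
        cost P⁺ (mmem Z) B                                ≡⟨ cost-split B ⟩
        cost P (mmem Z′) B + + bit (not (lookup B e))     ≡⟨ cong (λ b → cost P (mmem Z′) B + + bit (not b))
                                                                  B∋e ⟩
        cost P (mmem Z′) B + + 0                          ≡⟨ ℤ.+-identityʳ _ ⟩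
        cost P (mmem Z′) B                                ∎))
        where open ≡-Reasoning

      rank-add-X : ∀ x → inX e x ≡ true → mmem Z′ e x ≡ false → rankWith P (mset Z′ e x true) ≡ rank⁺
      rank-add-X x x∈X x∉Z′ = minOverSubsets-cong (λ A → trans
        (cost-addCell e x (λ _ _ _ → refl) (mmem-mset-other Z′ e x true)
          (X⊆P e x x∈X) (mmem-mset-self Z′ e x true) x∉Z′ A)
        (sym (cost-split A)))

      rank-add-present : ∀ x → mmem Z′ e x ≡ true → rankWith P (mset Z′ e x true) ≡ rank⁻
      rank-add-present x x∈Z′ = minOverSubsets-cong (cost-cong same (λ _ _ _ → refl))
        where
        same : ∀ f j → mmem (mset Z′ e x true) f j ≡ mmem Z′ f j
        same f j with ≡-dec _≟ᶠ_ _≟ᶠ_ (f , j) (e , x)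
        ... | yes refl   = trans (mmem-mset-self Z′ e x true) (sym x∈Z′)
        ... | no fj≢ex = mmem-mset-other Z′ e x true f j fj≢ex

      -- If Z′ already contains X_e, adding the row e to a minimiser A makes u free.
      rank⁺≤rank⁻ : (∀ x → inX e x ≡ true → mmem Z′ e x ≡ true) → rank⁺ ≤ rank⁻
      rank⁺≤rank⁻ X⊆Z′ with minOverSubsets-attained (cost P (mmem Z′))
      ... | A , rank⁻≡costA with lookup A e in A∋e
      ...   | true  = ℤ.≤-trans (rank⁺≤cost A A∋e) (ℤ.≤-reflexive (sym rank⁻≡costA))
      ...   | false = ℤ.≤-trans (rank⁺≤cost (A ∪ ⁅ e ⁆) (lookup-∪⁅⁆-self A e))
                  (ℤ.≤-trans (cost-∪⁅⁆-≤ P (mmem Z′) A e A∋e s≤k X-row)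
                    (ℤ.≤-reflexive (sym rank⁻≡costA)))
        where
        i∉X : inX e i ≡ false
        i∉X = 𝔹.¬-not (λ i∈X → contradiction (trans (sym (X⊆Z′ i i∈X)) (mmem-mset-self Z e i false)) λ ())
        s≤k : size e ℕ.≤ k
        s≤k = ℕ.≤-trans (ℕ.≮⇒≥ (λ i<s → subst T i∉X (ℕ.<⇒<ᵇ i<s))) (ℕ.<⇒≤ (toℕ<n i))
        X-row : ∀ j → inX e j ≡ true → mmem Z′ e j ≡ true × P e j ≡ true
        X-row j j∈X = X⊆Z′ j j∈X , X⊆P e j j∈X

      spanning⇒rank⁺≡rank⁻ : spans (rankWith P) Z′ e ≡ true → rank⁺ ≡ rank⁻
      spanning⇒rank⁺≡rank⁻ spanning
        with any? (λ x → (inX e x 𝔹.≟ true) ×-dec (mmem Z′ e x 𝔹.≟ false))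
      ... | yes (x , x∈X , x∉Z′) =
        trans (sym (rank-add-X x x∈X x∉Z′)) (spans-true (rankWith P) Z′ e spanning x x∈X)
      ... | no ∄ =
        ℤ.≤-antisym (rank⁺≤rank⁻ (λ x x∈X → 𝔹.¬-not (λ x∉Z′ → ∄ (x , x∈X , x∉Z′)))) rank⁻≤rank⁺

      non-spanning⇒rank⁺≡rank⁻+1 : spans (rankWith P) Z′ e ≡ false → rank⁺ ≡ rank⁻ + + 1
      non-spanning⇒rank⁺≡rank⁻+1 ¬spanning with spans-false (rankWith P) Z′ e ¬spanning
      ... | x , x∈X , changes = ℤ.≤-antisym rank⁺≤rank⁻+1 rank⁻+1≤rank⁺
        where
        x∉Z′ : mmem Z′ e x ≡ false
        x∉Z′ = 𝔹.¬-not (changes ∘ rank-add-present x)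
        rank⁻+1≤rank⁺ : rank⁻ + + 1 ≤ rank⁺
        rank⁻+1≤rank⁺ = subst (_≤ rank⁺) (ℤ.+-comm (+ 1) rank⁻) (ℤ.i<j⇒suc[i]≤j
          (ℤ.≤∧≢⇒< rank⁻≤rank⁺ (λ rank⁻≡rank⁺ → changes (trans (rank-add-X x x∈X x∉Z′) (sym rank⁻≡rank⁺)))))

      freeExt-present : rankWith P Z′ + (if spans (rankWith P) Z′ e then + 0 else + 1) ≡ rank⁺
      freeExt-present with spans (rankWith P) Z′ e in sp
      ... | true  = trans (ℤ.+-identityʳ rank⁻) (sym (spanning⇒rank⁺≡rank⁻ sp))
      ... | false = sym (non-spanning⇒rank⁺≡rank⁻+1 sp)

    freeExt-rankWith : ∀ Z → freeExt (rankWith P) (e , i) Z ≡ rankWith P⁺ Z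
    freeExt-rankWith Z with mmem Z e i in Z∋ei
    ... | true  = freeExt-present Z Z∋ei
    ... | false = minOverSubsets-cong (cost-cong (λ _ _ → refl) λ f j Z∋fj →
      sym (addCell-other P e i f j λ { refl → contradiction (trans (sym Z∋fj) Z∋ei) λ () }))

  foldl-freeExt : ∀ L P → IncludesX P → (r : MSub n k → ℤ) → (∀ Z → r Z ≡ rankWith P Z) →
    ∀ Z → List.foldl freeExt r L Z ≡ rankWith (addCells P L) Z
  foldl-freeExt []            P X⊆P r r≗ = r≗
  foldl-freeExt ((e , i) ∷ L) P X⊆P r r≗ =
    foldl-freeExt L (addCell P e i) (λ f j f∈X → cong (_∨ _) (X⊆P f j f∈X)) (freeExt r (e , i))
      (λ Z → trans (freeExt-cong r≗ (e , i) Z) (FreeExtensionStep.freeExt-rankWith P X⊆P e i Z))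

  ∈-newElems : ∀ f j → inX f j ≡ false → (f , j) ∈ newElems
  ∈-newElems f j j∉X = ∈-concatMap⁺ _ (lose (∈-allFin f) (∈-map⁺ (f ,_)
    (∈-filter⁺ (λ i → size f ℕ.≤? toℕ i) (∈-allFin j)
      (ℕ.≮⇒≥ (λ j<s → subst T j∉X (ℕ.<⇒<ᵇ j<s))))))

  addCells-newElems : ∀ f j → addCells inX newElems f j ≡ true
  addCells-newElems f j with inX f j in fj∈X
  ... | true  = addCells-⊇ inX newElems f j fj∈X
  ... | false = addCells-∈ inX newElems f j (∈-newElems f j fj∈X)

  rank-formula : ∀ Z → kNatural k σ Z ≡ minOverSubsets (λ A → σ A + + outsideRows (mmem Z) A)
  rank-formula Z = begin
    List.foldl freeExt natRank newElems Z
      ≡⟨ foldl-freeExt newElems inX (λ _ _ p → p) natRank natRank≡rankWith-inX Z ⟩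
    rankWith (addCells inX newElems) Z
      ≡⟨ minOverSubsets-cong (λ A → cong (λ c → σ A + + c) (gridCount-cong (all-covered A))) ⟩
    minOverSubsets (λ A → σ A + + outsideRows (mmem Z) A)
      ∎
    where
    open ≡-Reasoning
    all-covered : ∀ A f j → mmem Z f j ∧ not (lookup A f ∧ addCells inX newElems f j)
                            ≡ mmem Z f j ∧ not (lookup A f)
    all-covered A f j rewrite addCells-newElems f j | 𝔹.∧-identityʳ (lookup A f) = refl

-- k-duality

0≤j⇒i≤i+j : ∀ i {j} → + 0 ≤ j → i ≤ i + j
0≤j⇒i≤i+j i 0≤j = subst (_≤ i + _) (ℤ.+-identityʳ i) (ℤ.+-monoʳ-≤ i 0≤j)

kDual-⁅⁆ : ∀ {n} k (ρ : Subset n → ℤ) e → kDual k ρ ⁅ e ⁆ ≡ (+ k - ρ Sub.⊤) + ρ (∁ ⁅ e ⁆)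
kDual-⁅⁆ k ρ e = cong (λ c → (+ c - ρ Sub.⊤) + ρ (∁ ⁅ e ⁆))
  (trans (cong (k ℕ.*_) (∣⁅x⁆∣≡1 e)) (ℕ.*-identityʳ k))

module KPolymatroid {n k : ℕ} {ρ : Subset n → ℤ} (isKPoly : IsKPolymatroid k ρ) where

  open IsKPolymatroid isKPoly

  nonneg : ∀ X → + 0 ≤ ρ X
  nonneg X = subst (_≤ ρ X) normalized (nondecreasing Sub.⊥ X (⊆-min X))

  subadditive : ∀ X Y → ρ (X ∪ Y) ≤ ρ X + ρ Y
  subadditive X Y = ℤ.≤-trans (0≤j⇒i≤i+j _ (nonneg (X ∩ Y))) (submodular X Y)

  ⊤-≤ : ∀ e → ρ Sub.⊤ ≤ ρ (∁ ⁅ e ⁆) + + k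
  ⊤-≤ e = begin
    ρ Sub.⊤                 ≡⟨ cong ρ (p∪∁p≡⊤ ⁅ e ⁆) ⟨
    ρ (⁅ e ⁆ ∪ ∁ ⁅ e ⁆)     ≤⟨ subadditive ⁅ e ⁆ (∁ ⁅ e ⁆) ⟩
    ρ ⁅ e ⁆ + ρ (∁ ⁅ e ⁆)   ≤⟨ ℤ.+-monoˡ-≤ (ρ (∁ ⁅ e ⁆)) (bounded e) ⟩
    + k + ρ (∁ ⁅ e ⁆)       ≡⟨ ℤ.+-comm (+ k) (ρ (∁ ⁅ e ⁆)) ⟩
    ρ (∁ ⁅ e ⁆) + + k       ∎
    where open ℤ.≤-Reasoning

  kDual-⁅⁆-nonneg : ∀ e → + 0 ≤ kDual k ρ ⁅ e ⁆
  kDual-⁅⁆-nonneg e =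
    subst (+ 0 ≤_) (trans (reorder (+ k) (ρ Sub.⊤) (ρ (∁ ⁅ e ⁆))) (sym (kDual-⁅⁆ k ρ e)))
      (ℤ.i≤j⇒0≤j-i (⊤-≤ e))
    where
    reorder : ∀ K t c → (c + K) - t ≡ (K - t) + c
    reorder = ℤ-Ring.solve-∀

  kDual-∪⁅⁆-≤ : ∀ A e → kDual k ρ (A ∪ ⁅ e ⁆) ≤ kDual k ρ A + kDual k ρ ⁅ e ⁆
  kDual-∪⁅⁆-≤ A e with lookup A e in e∈A
  ... | true  rewrite ∪⁅⁆-idem A e e∈A = 0≤j⇒i≤i+j (kDual k ρ A) (kDual-⁅⁆-nonneg e)
  ... | false = begin
    kDual k ρ (A ∪ ⁅ e ⁆)
      ≡⟨ cong₂ (λ c X → (+ (k ℕ.* c) - ρ Sub.⊤) + ρ X) (∣∪⁅⁆∣ A e e∈A)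
               (BooleanAlgebra.deMorgan₂ (∪-∩-booleanAlgebra n) A ⁅ e ⁆) ⟩
    (+ (k ℕ.* suc Sub.∣ A ∣) - ρ Sub.⊤) + ρ (∁ A ∩ ∁ ⁅ e ⁆)
      ≡⟨ cong (λ c → (+ c - ρ Sub.⊤) + ρ (∁ A ∩ ∁ ⁅ e ⁆)) (ℕ.*-suc k Sub.∣ A ∣) ⟩
    (+ k + + (k ℕ.* Sub.∣ A ∣) - ρ Sub.⊤) + ρ (∁ A ∩ ∁ ⁅ e ⁆)
      ≤⟨ rearrange (+ k) (+ (k ℕ.* Sub.∣ A ∣)) (ρ Sub.⊤) (ρ (∁ A ∩ ∁ ⁅ e ⁆)) (ρ (∁ A)) (ρ (∁ ⁅ e ⁆))
                   submodular-∁ ⟩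
    ((+ (k ℕ.* Sub.∣ A ∣) - ρ Sub.⊤) + ρ (∁ A)) + ((+ k - ρ Sub.⊤) + ρ (∁ ⁅ e ⁆))
      ≡⟨ cong (λ t → kDual k ρ A + t) (kDual-⁅⁆ k ρ e) ⟨
    kDual k ρ A + kDual k ρ ⁅ e ⁆
      ∎
    where
    open ℤ.≤-Reasoning
    submodular-∁ : ρ Sub.⊤ + ρ (∁ A ∩ ∁ ⁅ e ⁆) ≤ ρ (∁ A) + ρ (∁ ⁅ e ⁆)
    submodular-∁ = subst (λ X → ρ X + ρ (∁ A ∩ ∁ ⁅ e ⁆) ≤ ρ (∁ A) + ρ (∁ ⁅ e ⁆))
      (∁∪∁⁅⁆≡⊤ A e e∈A) (submodular (∁ A) (∁ ⁅ e ⁆))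
    rearrange : ∀ K c t r p q → t + r ≤ p + q → (K + c - t) + r ≤ (c - t + p) + (K - t + q)
    rearrange K c t r p q t+r≤p+q = subst ((K + c - t) + r ≤_) (identity K c t r p q)
      (0≤j⇒i≤i+j _ (ℤ.i≤j⇒0≤j-i t+r≤p+q))
      where
      identity : ∀ K c t r p q → (K + c - t) + r + ((p + q) - (t + r)) ≡ (c - t + p) + (K - t + q)
      identity = ℤ-Ring.solve-∀

outsideRows-∁-row : ∀ {k} b (p : Fin k → Bool) →
  k ℕ.* bit b ℕ.+ count (λ j → not (p j) ∧ not b) ℕ.+ count p ≡ k ℕ.+ count (λ j → p j ∧ not (not b))
outsideRows-∁-row {k} true p = begin
  k ℕ.* 1 ℕ.+ count (λ j → not (p j) ∧ false) ℕ.+ count p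
    ≡⟨ cong₂ (λ a c → a ℕ.+ c ℕ.+ count p) (ℕ.*-identityʳ k)
             (trans (count-cong (λ j → 𝔹.∧-zeroʳ (not (p j)))) (count-false k)) ⟩
  k ℕ.+ 0 ℕ.+ count p
    ≡⟨ cong₂ ℕ._+_ (ℕ.+-identityʳ k) (count-cong (λ j → sym (𝔹.∧-identityʳ (p j)))) ⟩
  k ℕ.+ count (λ j → p j ∧ true)
    ∎
  where open ≡-Reasoning
outsideRows-∁-row {k} false p = begin
  k ℕ.* 0 ℕ.+ count (λ j → not (p j) ∧ true) ℕ.+ count p
    ≡⟨ cong₂ (λ a c → a ℕ.+ c ℕ.+ count p) (ℕ.*-zeroʳ k)
             (count-cong (λ j → 𝔹.∧-identityʳ (not (p j)))) ⟩
  count (not ∘ p) ℕ.+ count p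
    ≡⟨ ℕ.+-comm (count (not ∘ p)) (count p) ⟩
  count p ℕ.+ count (not ∘ p)
    ≡⟨ count-+-count-not p ⟩
  k
    ≡⟨ ℕ.+-identityʳ k ⟨
  k ℕ.+ 0
    ≡⟨ cong (k ℕ.+_) (trans (count-cong (λ j → 𝔹.∧-zeroʳ (p j))) (count-false k)) ⟨
  k ℕ.+ count (λ j → p j ∧ false)
    ∎
  where open ≡-Reasoning

outsideRows-∁ : ∀ {n k} (z : Grid n k) (B : Subset n) →
  k ℕ.* Sub.∣ B ∣ ℕ.+ outsideRows (λ f j → not (z f j)) B ℕ.+ gridCount z
    ≡ n ℕ.* k ℕ.+ outsideRows z (∁ B)
outsideRows-∁ {n} {k} z B = begin
  k ℕ.* Sub.∣ B ∣ ℕ.+ sum z̄B ℕ.+ sum zs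
    ≡⟨ cong (λ c → k ℕ.* c ℕ.+ sum z̄B ℕ.+ sum zs) (∣∣≡count B) ⟩
  k ℕ.* sum (bit ∘ lookup B) ℕ.+ sum z̄B ℕ.+ sum zs
    ≡⟨ cong (λ t → t ℕ.+ sum z̄B ℕ.+ sum zs) (*-distribˡ-sum k (bit ∘ lookup B)) ⟩
  sum kB ℕ.+ sum z̄B ℕ.+ sum zs
    ≡⟨ cong (ℕ._+ sum zs) (∑-distrib-+ kB z̄B) ⟨
  sum (λ f → kB f ℕ.+ z̄B f) ℕ.+ sum zs
    ≡⟨ ∑-distrib-+ (λ f → kB f ℕ.+ z̄B f) zs ⟨
  sum (λ f → kB f ℕ.+ z̄B f ℕ.+ zs f)
    ≡⟨ sum-cong-≗ (λ f → trans (outsideRows-∁-row (lookup B f) (z f))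
         (cong (λ b → k ℕ.+ count (λ j → z f j ∧ not b)) (sym (Vec.lookup-map f not B)))) ⟩
  sum (λ f → k ℕ.+ count (λ j → z f j ∧ not (lookup (∁ B) f)))
    ≡⟨ ∑-distrib-+ (λ _ → k) (λ f → count (λ j → z f j ∧ not (lookup (∁ B) f))) ⟩
  sum {n} (λ _ → k) ℕ.+ outsideRows z (∁ B)
    ≡⟨ cong (ℕ._+ outsideRows z (∁ B)) (sum-const n k) ⟩
  n ℕ.* k ℕ.+ outsideRows z (∁ B)
    ∎
  where
  open ≡-Reasoning
  kB z̄B zs : Fin n → ℕ
  kB f = k ℕ.* bit (lookup B f)
  z̄B f = count (λ j → not (z f j) ∧ not (lookup B f))
  zs f = count (z f)

module Duality {n k : ℕ} {g : Subset n → ℤ} (isKPoly : IsKPolymatroid k g)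
  (σ : Subset n → ℤ) (σ≗g* : ∀ B → σ B ≡ kDual k g B) where

  open IsKPolymatroid isKPoly using (normalized)
  open KPolymatroid isKPoly

  private
    module Rank-g = RankFormula k g (nonneg ∘ ⁅_⁆) (λ A e → subadditive A ⁅ e ⁆)
    module Rank-σ = RankFormula k σ
      (λ e → subst (+ 0 ≤_) (sym (σ≗g* ⁅ e ⁆)) (kDual-⁅⁆-nonneg e))
      (λ A e → subst₂ _≤_ (sym (σ≗g* (A ∪ ⁅ e ⁆))) (sym (cong₂ _+_ (σ≗g* A) (σ≗g* ⁅ e ⁆)))
                 (kDual-∪⁅⁆-≤ A e))

  shift : Grid n k → ℤ
  shift z = (+ (n ℕ.* k) - + gridCount z) - g Sub.⊤

  kDual-cost : ∀ (z : Grid n k) B →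
    kDual k g B + + outsideRows (λ f j → not (z f j)) B ≡ (g (∁ B) + + outsideRows z (∁ B)) + shift z
  kDual-cost z B = rearrange (+ (k ℕ.* Sub.∣ B ∣)) _ (+ gridCount z) (+ (n ℕ.* k)) _ (g (∁ B)) (g Sub.⊤)
    (cong +_ (outsideRows-∁ z B))
    where
    rearrange : ∀ kB o¬ cz nk oz g∁ g⊤ → kB + o¬ + cz ≡ nk + oz →
      (kB - g⊤ + g∁) + o¬ ≡ (g∁ + oz) + ((nk - cz) - g⊤)
    rearrange kB o¬ cz nk oz g∁ g⊤ counts = begin
      (kB - g⊤ + g∁) + o¬                  ≡⟨ lhs kB o¬ cz g∁ g⊤ ⟩
      (g∁ - g⊤) + (kB + o¬ + cz) - cz      ≡⟨ cong (λ t → (g∁ - g⊤) + t - cz) counts ⟩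
      (g∁ - g⊤) + (nk + oz) - cz           ≡⟨ rhs nk oz cz g∁ g⊤ ⟩
      (g∁ + oz) + ((nk - cz) - g⊤)         ∎
      where
      open ≡-Reasoning
      lhs : ∀ kB o¬ cz g∁ g⊤ → (kB - g⊤ + g∁) + o¬ ≡ (g∁ - g⊤) + (kB + o¬ + cz) - cz
      lhs = ℤ-Ring.solve-∀
      rhs : ∀ nk oz cz g∁ g⊤ → (g∁ - g⊤) + (nk + oz) - cz ≡ (g∁ + oz) + ((nk - cz) - g⊤)
      rhs = ℤ-Ring.solve-∀

  rank-σ-complement : ∀ W (z : Grid n k) → (∀ f j → mmem W f j ≡ not (z f j)) →
    kNatural k σ W ≡ minOverSubsets (λ A → g A + + outsideRows z A) + shift z
  rank-σ-complement W z W≗z̄ = begin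
    kNatural k σ W
      ≡⟨ Rank-σ.rank-formula W ⟩
    minOverSubsets (λ B → σ B + + outsideRows (mmem W) B)
      ≡⟨ minOverSubsets-cong (λ B → trans
           (cong₂ (λ s o → s + + o) (σ≗g* B) (gridCount-cong (λ f j → cong (_∧ _) (W≗z̄ f j))))
           (kDual-cost z B)) ⟩
    minOverSubsets (λ B → h (∁ B) + shift z)
      ≡⟨ minOverSubsets-+ (h ∘ ∁) (shift z) ⟩
    minOverSubsets (h ∘ ∁) + shift z
      ≡⟨ cong (_+ shift z) (minOverSubsets-∘∁ h) ⟩
    minOverSubsets h + shift z
      ∎
    where
    open ≡-Reasoning
    h : Subset n → ℤ
    h A = g A + + outsideRows z A

  rank-σ-full : kNatural k σ mfull ≡ + (n ℕ.* k) - g Sub.⊤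
  rank-σ-full = begin
    kNatural k σ mfull
      ≡⟨ rank-σ-complement mfull empty full ⟩
    minOverSubsets (λ A → g A + + outsideRows empty A) + shift empty
      ≡⟨ cong₂ _+_ min≡0 (cong (λ c → (+ (n ℕ.* k) - + c) - g Sub.⊤) (gridCount-noCells n k)) ⟩
    + 0 + ((+ (n ℕ.* k) - + 0) - g Sub.⊤)
      ≡⟨ ℤ.+-identityˡ _ ⟩
    (+ (n ℕ.* k) + + 0) - g Sub.⊤
      ≡⟨ cong (_- g Sub.⊤) (ℤ.+-identityʳ (+ (n ℕ.* k))) ⟩
    + (n ℕ.* k) - g Sub.⊤
      ∎
    where
    open ≡-Reasoning
    empty : Grid n k
    empty = noCells
    full : ∀ f j → mmem (mfull {n} {k}) f j ≡ true
    full f j = trans (cong (λ S → lookup S j) (Vec.lookup-replicate f Sub.⊤)) (Vec.lookup-replicate j true)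
    min≡0 : minOverSubsets (λ A → g A + + outsideRows empty A) ≡ + 0
    min≡0 = minOverSubsets-unique (λ A → g A + + outsideRows empty A) (+ 0)
      (λ A → ℤ.≤-trans (nonneg A) (0≤j⇒i≤i+j (g A) (+≤+ ℕ.z≤n)))
      (Sub.⊥ , cong₂ _+_ normalized (cong +_ (gridCount-noCells n k)))

  rank-σ-compl : ∀ Z → kNatural k σ (mcompl Z) ≡ kNatural k g Z + ((+ (n ℕ.* k) - + card Z) - g Sub.⊤)
  rank-σ-compl Z = trans (rank-σ-complement (mcompl Z) (mmem Z) compl)
    (cong₂ _+_ (sym (Rank-g.rank-formula Z))
      (cong (λ c → (+ (n ℕ.* k) - + c) - g Sub.⊤) (sym (card≡gridCount Z))))
    where
    compl : ∀ f j → mmem (mcompl Z) f j ≡ not (mmem Z f j)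
    compl f j = trans (cong (λ S → lookup S j) (Vec.lookup-map f ∁ Z)) (Vec.lookup-map j not (lookup Z f))

  kNatural-kDual : ∀ Z → kNatural k g Z ≡ mdual (kNatural k σ) Z
  kNatural-kDual Z = sym (begin
    (+ card Z - kNatural k σ mfull) + kNatural k σ (mcompl Z)
      ≡⟨ cong₂ (λ a b → (+ card Z - a) + b) rank-σ-full (rank-σ-compl Z) ⟩
    (+ card Z - (+ (n ℕ.* k) - g Sub.⊤)) + (kNatural k g Z + ((+ (n ℕ.* k) - + card Z) - g Sub.⊤))
      ≡⟨ cancel (+ card Z) (+ (n ℕ.* k)) (g Sub.⊤) (kNatural k g Z) ⟩
    kNatural k g Z
      ∎)
    where
    open ≡-Reasoning
    cancel : ∀ c nk g⊤ r → (c - (nk - g⊤)) + (r + ((nk - c) - g⊤)) ≡ r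
    cancel = ℤ-Ring.solve-∀

-- Deletion and contraction

insertAt-zipWith : ∀ {n} (_∙_ : Bool → Bool → Bool) (X Y : Subset n) e a b →
  insertAt (zipWith _∙_ X Y) e (a ∙ b) ≡ zipWith _∙_ (insertAt X e a) (insertAt Y e b)
insertAt-zipWith _∙_ X       Y       zero    a b = refl
insertAt-zipWith _∙_ (x ∷ X) (y ∷ Y) (suc e) a b = cong ((x ∙ y) ∷_) (insertAt-zipWith _∙_ X Y e a b)

insertAt-replicate : ∀ {n} (e : Fin (suc n)) (b : Bool) → insertAt (replicate n b) e b ≡ replicate (suc n) b
insertAt-replicate         zero    b = refl
insertAt-replicate {suc n} (suc e) b = cong (b ∷_) (insertAt-replicate e b)

insertAt-⊥-inside : ∀ {n} (e : Fin (suc n)) → insertAt Sub.⊥ e inside ≡ ⁅ e ⁆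
insertAt-⊥-inside         zero    = refl
insertAt-⊥-inside {suc n} (suc e) = cong (outside ∷_) (insertAt-⊥-inside e)

insertAt-⁅⁆-outside : ∀ {n} (e : Fin (suc n)) (f : Fin n) → insertAt ⁅ f ⁆ e outside ≡ ⁅ punchIn e f ⁆
insertAt-⁅⁆-outside zero    f       = refl
insertAt-⁅⁆-outside (suc e) zero    = cong (inside ∷_) (insertAt-replicate e outside)
insertAt-⁅⁆-outside (suc e) (suc f) = cong (outside ∷_) (insertAt-⁅⁆-outside e f)

insertAt-⁅⁆-inside : ∀ {n} (e : Fin (suc n)) (f : Fin n) →
  insertAt ⁅ f ⁆ e inside ≡ ⁅ punchIn e f ⁆ ∪ ⁅ e ⁆
insertAt-⁅⁆-inside e f = begin
  insertAt ⁅ f ⁆ e inside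
    ≡⟨ cong (λ S → insertAt S e inside) (∪-identityʳ ⁅ f ⁆) ⟨
  insertAt (⁅ f ⁆ ∪ Sub.⊥) e (outside ∨ inside)
    ≡⟨ insertAt-zipWith _∨_ ⁅ f ⁆ Sub.⊥ e outside inside ⟩
  insertAt ⁅ f ⁆ e outside ∪ insertAt Sub.⊥ e inside
    ≡⟨ cong₂ _∪_ (insertAt-⁅⁆-outside e f) (insertAt-⊥-inside e) ⟩
  ⁅ punchIn e f ⁆ ∪ ⁅ e ⁆
    ∎
  where open ≡-Reasoning

∁-insertAt : ∀ {n} (X : Subset n) e b → ∁ (insertAt X e b) ≡ insertAt (∁ X) e (not b)
∁-insertAt X e b = Vec.map-insertAt not b X e

∁⁅⁆≡insertAt-⊤ : ∀ {n} (e : Fin (suc n)) → ∁ ⁅ e ⁆ ≡ insertAt Sub.⊤ e outside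
∁⁅⁆≡insertAt-⊤ {n} e = begin
  ∁ ⁅ e ⁆                          ≡⟨ cong ∁ (insertAt-⊥-inside e) ⟨
  ∁ (insertAt Sub.⊥ e inside)      ≡⟨ ∁-insertAt Sub.⊥ e inside ⟩
  insertAt (∁ Sub.⊥) e outside     ≡⟨ cong (λ S → insertAt S e outside)
                                         (BooleanAlgebra.¬⊥≈⊤ (∪-∩-booleanAlgebra n)) ⟩
  insertAt Sub.⊤ e outside         ∎
  where open ≡-Reasoning

∣insertAt∣ : ∀ {n} (X : Subset n) e b → Sub.∣ insertAt X e b ∣ ≡ bit b ℕ.+ Sub.∣ X ∣
∣insertAt∣ X             zero    inside  = refl
∣insertAt∣ X             zero    outside = refl
∣insertAt∣ (inside ∷ X)  (suc e) b       = trans (cong suc (∣insertAt∣ X e b)) (sym (ℕ.+-suc (bit b) _))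
∣insertAt∣ (outside ∷ X) (suc e) b       = ∣insertAt∣ X e b

insertAt-⊆ : ∀ {n} {X Y : Subset n} e b → X ⊆ Y → insertAt X e b ⊆ insertAt Y e b
insertAt-⊆ zero b X⊆Y = s⊆s X⊆Y
insertAt-⊆ {X = outside ∷ X} {y ∷ Y} (suc e) b X⊆Y = out⊆ (insertAt-⊆ e b (drop-∷-⊆ X⊆Y))
insertAt-⊆ {X = inside ∷ X} {y ∷ Y} (suc e) b X⊆Y with X⊆Y Vec.here   -- forces y = inside
... | Vec.here = in⊆in (insertAt-⊆ e b (drop-∷-⊆ X⊆Y))

module _ {n k : ℕ} {ρ : Subset (suc n) → ℤ} (isKPoly : IsKPolymatroid k ρ) (e : Fin (suc n)) where

  open IsKPolymatroid isKPoly
  open KPolymatroid isKPoly using (subadditive)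

  insertAt-submodular : ∀ X Y b → ρ (insertAt (X ∪ Y) e b) + ρ (insertAt (X ∩ Y) e b)
                                    ≤ ρ (insertAt X e b) + ρ (insertAt Y e b)
  insertAt-submodular X Y b = subst₂ (λ U V → ρ U + ρ V ≤ ρ (insertAt X e b) + ρ (insertAt Y e b))
    (trans (sym (insertAt-zipWith _∨_ X Y e b b)) (cong (λ b′ → insertAt (X ∪ Y) e b′) (𝔹.∨-idem b)))
    (trans (sym (insertAt-zipWith _∧_ X Y e b b)) (cong (λ b′ → insertAt (X ∩ Y) e b′) (𝔹.∧-idem b)))
    (submodular (insertAt X e b) (insertAt Y e b))

  deletion-isKPolymatroid : IsKPolymatroid k (deletion ρ e)
  deletion-isKPolymatroid = record
    { normalized    = trans (cong ρ (insertAt-replicate e outside)) normalized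
    ; nondecreasing = λ X Y X⊆Y → nondecreasing _ _ (insertAt-⊆ e outside X⊆Y)
    ; submodular    = λ X Y → insertAt-submodular X Y outside
    ; bounded       = λ f → subst (λ S → ρ S ≤ + k) (sym (insertAt-⁅⁆-outside e f)) (bounded (punchIn e f))
    }

  contraction-isKPolymatroid : IsKPolymatroid k (contraction ρ e)
  contraction-isKPolymatroid = record
    { normalized    = trans (cong (λ S → ρ S - ρ ⁅ e ⁆) (insertAt-⊥-inside e)) (ℤ.+-inverseʳ (ρ ⁅ e ⁆))
    ; nondecreasing = λ X Y X⊆Y → ℤ.+-monoˡ-≤ (- ρ ⁅ e ⁆) (nondecreasing _ _ (insertAt-⊆ e inside X⊆Y))
    ; submodular    = λ X Y → subtract-twice (ρ (insertAt (X ∪ Y) e inside)) (ρ (insertAt (X ∩ Y) e inside))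
                                (ρ (insertAt X e inside)) (ρ (insertAt Y e inside)) (insertAt-submodular X Y inside)
    ; bounded       = bounded′
    }
    where
    c : ℤ
    c = ρ ⁅ e ⁆
    subtract-twice : ∀ a b p q → a + b ≤ p + q → (a - c) + (b - c) ≤ (p - c) + (q - c)
    subtract-twice a b p q ≤ = subst₂ _≤_ (shuffle a b c) (shuffle p q c) (ℤ.+-monoˡ-≤ (- c + - c) ≤)
      where
      shuffle : ∀ a b c → (a + b) + (- c + - c) ≡ (a - c) + (b - c)
      shuffle = ℤ-Ring.solve-∀
    bounded′ : ∀ f → contraction ρ e ⁅ f ⁆ ≤ + k
    bounded′ f = begin
      ρ (insertAt ⁅ f ⁆ e inside) - c   ≡⟨ cong (λ S → ρ S - c) (insertAt-⁅⁆-inside e f) ⟩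
      ρ (⁅ punchIn e f ⁆ ∪ ⁅ e ⁆) - c   ≤⟨ ℤ.+-monoˡ-≤ (- c) (subadditive ⁅ punchIn e f ⁆ ⁅ e ⁆) ⟩
      ρ ⁅ punchIn e f ⁆ + c - c         ≡⟨ cancel (ρ ⁅ punchIn e f ⁆) c ⟩
      ρ ⁅ punchIn e f ⁆                 ≤⟨ bounded (punchIn e f) ⟩
      + k                               ∎
      where
      open ℤ.≤-Reasoning
      cancel : ∀ a c → a + c - c ≡ a
      cancel = ℤ-Ring.solve-∀

module _ {n : ℕ} (k : ℕ) (ρ : Subset (suc n) → ℤ) (e : Fin (suc n)) (B : Subset n) where

  contraction-kDual : contraction (kDual k ρ) e B ≡ kDual k (deletion ρ e) B
  contraction-kDual = begin
    kDual k ρ (insertAt B e inside) - kDual k ρ ⁅ e ⁆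
      ≡⟨ cong₂ _-_ inserted
           (trans (kDual-⁅⁆ k ρ e) (cong (λ X → (+ k - ρ Sub.⊤) + ρ X) (∁⁅⁆≡insertAt-⊤ e))) ⟩
    ((+ k + + (k ℕ.* Sub.∣ B ∣) - ρ Sub.⊤) + ρ (insertAt (∁ B) e outside))
      - ((+ k - ρ Sub.⊤) + ρ (insertAt Sub.⊤ e outside))
      ≡⟨ cancel (+ k) (+ (k ℕ.* Sub.∣ B ∣)) (ρ Sub.⊤)
                (ρ (insertAt (∁ B) e outside)) (ρ (insertAt Sub.⊤ e outside)) ⟩
    (+ (k ℕ.* Sub.∣ B ∣) - ρ (insertAt Sub.⊤ e outside)) + ρ (insertAt (∁ B) e outside)
      ∎
    where
    open ≡-Reasoning
    inserted : kDual k ρ (insertAt B e inside)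
             ≡ (+ k + + (k ℕ.* Sub.∣ B ∣) - ρ Sub.⊤) + ρ (insertAt (∁ B) e outside)
    inserted = cong₂ (λ c X → (+ c - ρ Sub.⊤) + ρ X)
      (trans (cong (k ℕ.*_) (∣insertAt∣ B e inside)) (ℕ.*-suc k Sub.∣ B ∣)) (∁-insertAt B e inside)
    cancel : ∀ K KB t a u → ((K + KB - t) + a) - ((K - t) + u) ≡ (KB - u) + a
    cancel = ℤ-Ring.solve-∀

  deletion-kDual : deletion (kDual k ρ) e B ≡ kDual k (contraction ρ e) B
  deletion-kDual = begin
    (+ (k ℕ.* Sub.∣ insertAt B e outside ∣) - ρ Sub.⊤) + ρ (∁ (insertAt B e outside))
      ≡⟨ cong₂ (λ c X → (+ (k ℕ.* c) - ρ Sub.⊤) + ρ X)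
               (∣insertAt∣ B e outside) (∁-insertAt B e outside) ⟩
    (+ (k ℕ.* Sub.∣ B ∣) - ρ Sub.⊤) + ρ (insertAt (∁ B) e inside)
      ≡⟨ regroup (+ (k ℕ.* Sub.∣ B ∣)) (ρ Sub.⊤) (ρ (insertAt (∁ B) e inside)) (ρ ⁅ e ⁆) ⟩
    (+ (k ℕ.* Sub.∣ B ∣) - (ρ Sub.⊤ - ρ ⁅ e ⁆)) + (ρ (insertAt (∁ B) e inside) - ρ ⁅ e ⁆)
      ≡⟨ cong (λ S → (+ (k ℕ.* Sub.∣ B ∣) - (ρ S - ρ ⁅ e ⁆))
                     + (ρ (insertAt (∁ B) e inside) - ρ ⁅ e ⁆))
              (insertAt-replicate e inside) ⟨
    (+ (k ℕ.* Sub.∣ B ∣) - contraction ρ e Sub.⊤) + contraction ρ e (∁ B)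
      ∎
    where
    open ≡-Reasoning
    regroup : ∀ KB t a c → (KB - t) + a ≡ (KB - (t - c)) + (a - c)
    regroup = ℤ-Ring.solve-∀

lemma4p6 : {n : ℕ} (k : ℕ) (ρ : Subset (suc n) → ℤ) → IsKPolymatroid k ρ →
    (e : Fin (suc n)) →
      ((Z : MSub n k) →
        kNatural k (deletion ρ e) Z ≡ mdual (kNatural k (contraction (kDual k ρ) e)) Z)
      × ((Z : MSub n k) →
        kNatural k (contraction ρ e) Z ≡ mdual (kNatural k (deletion (kDual k ρ) e)) Z)
lemma4p6 k ρ isKPoly e =
    Duality.kNatural-kDual (deletion-isKPolymatroid isKPoly e)
      (contraction (kDual k ρ) e) (contraction-kDual k ρ e)
  , Duality.kNatural-kDual (contraction-isKPolymatroid isKPoly e)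
      (deletion (kDual k ρ) e) (deletion-kDual k ρ e)
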